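{- Let $3\le k<n-1$ and $V=\mathbb{F}_2^n$. For every $(k-1)$-dimensional subspace $X\subset V$ with $c(X)\le n-k$ there exist $Y,Y'\in\mathcal{C}(n,k)_2$ such that $X=Y\cap Y'$ and each of $Y,Y'$ contains the vector $(1,\dots,1)$ or one of the vectors $v_i=(1,\dots,1)+e_i$, $i\in\{1,\dots,n\}$.
   Context: $V=\mathbb{F}_2^n$ with standard basis $e_1,\dots,e_n$, $C_i=\{x\in V:x_i=0\}$. $\mathcal{C}(n,k)_2$ is the set of $k$-dimensional subspaces of $V$ contained in no $C_i$. For a subspace $X$, $c(X)$ is the number of indices $i$ with $X\subset C_i$. -}

module Defs where

open import Data.Bool using (Bool; true; false; _xor_)
open import Data.Nat using (ℕ; _≤_)
open import Data.Fin using (Fin; _≟_)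
open import Data.Fin.Subset using (Subset; _∈_; ∣_∣)
open import Data.Vec using (Vec; []; _∷_; replicate; zipWith; lookup; tabulate)
open import Data.Product using (Σ; _×_)
open import Relation.Binary.PropositionalEquality using (_≡_)
open import Relation.Nullary using (¬_)
open import Relation.Nullary.Decidable using (⌊_⌋)

-- V = F₂ⁿ, vectors as Vec Bool n (true = 1, false = 0, addition = xor)
V : ℕ → Set
V n = Vec Bool n

_⊕_ : ∀ {n} → V n → V n → V n
_⊕_ = zipWith _xor_

𝟘 : ∀ {n} → V n
𝟘 = replicate _ false

𝟙 : ∀ {n} → V n
𝟙 = replicate _ true

e : ∀ {n} → Fin n → V n
e i = tabulate (λ j → ⌊ i ≟ j ⌋)

vv : ∀ {n} → Fin n → V n
vv i = 𝟙 ⊕ e i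

Pred : ℕ → Set₁
Pred n = V n → Set

-- linear subspace over F₂ (scalar multiplication by 0/1 is automatic)
record IsSubspace {n} (X : Pred n) : Set where
  field
    has-zero : X 𝟘
    closed-⊕ : ∀ {u v} → X u → X v → X (u ⊕ v)

lincomb : ∀ {n k} → Vec Bool k → Vec (V n) k → V n
lincomb [] [] = 𝟘
lincomb (true ∷ c) (b ∷ bs) = b ⊕ lincomb c bs
lincomb (false ∷ c) (b ∷ bs) = lincomb c bs

LinIndep : ∀ {n k} → Vec (V n) k → Set
LinIndep {k = k} B = ∀ (c : Vec Bool k) → lincomb c B ≡ 𝟘 → c ≡ replicate k false

InSpan : ∀ {n k} → Vec (V n) k → V n → Set
InSpan {k = k} B v = Σ (Vec Bool k) λ c → lincomb c B ≡ v

HasDim : ∀ {n} → Pred n → ℕ → Set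
HasDim {n} X k = IsSubspace X ×
  Σ (Vec (V n) k) λ B → LinIndep B × (∀ v → X v → InSpan B v) × (∀ v → InSpan B v → X v)

-- X ⊂ C_i = {x : x_i = 0}
InC : ∀ {n} → Pred n → Fin n → Set
InC X i = ∀ v → X v → lookup v i ≡ false

-- c(X) ≤ m : every set of indices i with X ⊂ C_i has at most m elements
c≤ : ∀ {n} → Pred n → ℕ → Set
c≤ {n} X m = ∀ (s : Subset n) → (∀ i → i ∈ s → InC X i) → ∣ s ∣ ≤ m

InCnk : ∀ n k → Pred n → Set
InCnk n k Y = HasDim Y k × (∀ (i : Fin n) → ¬ InC Y i)

ContainsSpecial : ∀ {n} → Pred n → Set
ContainsSpecial {n} Y = Y 𝟙 ⊎ Σ (Fin n) λ i → Y (vv i)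
  where open import Data.Sum using (_⊎_)

-- Write X = ⟨B⟩ and take Y = ⟨w, B⟩, Y′ = ⟨w′, B⟩ with w, w′, w + w′ ∉ X; then Y ∩ Y′ = X.
--
-- If (1,…,1) ∈ X, take w = eᵢ ∉ X and w′ = eⱼ ∉ X + ⟨eᵢ⟩: both Y and Y′ contain (1,…,1), so they
-- lie in no Cₜ. Otherwise take w = (1,…,1) and w′ = vᵢ, where X ⊄ Cᵢ and eᵢ, vᵢ ∉ X; then
-- w + w′ = eᵢ, and Y′ ∋ vᵢ leaves every Cₜ with t ≠ i while X already leaves Cᵢ. Such an i
-- exists by counting dimensions. If X lies in no Cₜ, pick eᵢ ∉ X + ⟨(1,…,1)⟩. If X ⊂ C_z for
-- some z, let Z be the set of all such indices; since dim X + |Z| ≤ (k − 1) + (n − k) < n, some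
-- eᵢ lies outside X + ⟨e_z : z ∈ Z⟩, so i ∉ Z, and vᵢ ∉ X because its z-th coordinate is 1.
--
-- The counting itself: if e₁,…,eₙ lie in the span of d vectors, the coefficient map F₂ⁿ → F₂ᵈ
-- is injective, hence n ≤ d.
module Submission where

open import Defs
open import Data.Nat using (ℕ; _≤_; _<_; _∸_)
open import Data.Product using (Σ; _×_)
open import Function.Bundles using (_⇔_)

open import Algebra.Bundles using (CommutativeSemigroup)
import Algebra.Properties.CommutativeSemigroup as CommutativeSemigroupProperties
open import Data.Bool as Bool using (Bool; true; false; _xor_)
import Data.Bool.Properties as BoolP
open import Data.Fin using (Fin; zero; suc; _≟_; funToFin; finToFun; combine)
import Data.Fin.Properties as FinP
open import Data.Fin.Subset using (Subset; _∈_; ∣_∣)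
open import Data.Nat as ℕ using (_+_; _^_; s≤s; z≤n)
import Data.Nat.Properties as ℕP
open import Data.Product using (_,_; proj₁; proj₂; ∃)
open import Data.Sum using (_⊎_; inj₁; inj₂)
open import Data.Vec using (Vec; []; _∷_; here; there; replicate; lookup; tabulate; map; _++_)
open import Data.Vec.Relation.Unary.All using (All; []; _∷_)
open import Data.Vec.Relation.Unary.All.Properties using (tabulate⁺)
import Data.Vec.Properties as VecP
open import Function using (_∘_; id)
open import Function.Bundles using (_↔_; mk↔ₛ′; mk⇔; Inverse; Injection; Equivalence)
open import Function.Construct.Composition as Composition using (_⇔-∘_)
open import Function.Properties.Inverse using (↔⇒↣; ↔-sym)
open import Function.Definitions using (Injective)
open import Relation.Binary.PropositionalEquality
open import Relation.Nullary using (¬_; Dec; yes; no; contradiction)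
open import Relation.Nullary.Decidable using (map′; ⌊_⌋; toWitness; fromWitness)
open import Relation.Unary using (Decidable)

private
  variable
    n m d : ℕ

-- Vector algebra over F₂

⊕-assoc : (u v w : V n) → (u ⊕ v) ⊕ w ≡ u ⊕ (v ⊕ w)
⊕-assoc = VecP.zipWith-assoc BoolP.xor-assoc

⊕-comm : (u v : V n) → u ⊕ v ≡ v ⊕ u
⊕-comm = VecP.zipWith-comm BoolP.xor-comm

⊕-identityˡ : (u : V n) → 𝟘 ⊕ u ≡ u
⊕-identityˡ = VecP.zipWith-identityˡ BoolP.xor-identityˡ

⊕-identityʳ : (u : V n) → u ⊕ 𝟘 ≡ u
⊕-identityʳ = VecP.zipWith-identityʳ BoolP.xor-identityʳ

⊕-same : (u : V n) → u ⊕ u ≡ 𝟘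
⊕-same []      = refl
⊕-same (a ∷ u) = cong₂ _∷_ (BoolP.xor-same a) (⊕-same u)

⊕-commutativeSemigroup : ℕ → CommutativeSemigroup _ _
⊕-commutativeSemigroup n = record
  { Carrier                = V n
  ; _≈_                    = _≡_
  ; _∙_                    = _⊕_
  ; isCommutativeSemigroup = record
    { isSemigroup = record
      { isMagma = record { isEquivalence = isEquivalence ; ∙-cong = cong₂ _⊕_ }
      ; assoc   = ⊕-assoc
      }
    ; comm        = ⊕-comm
    }
  }

module _ {n : ℕ} where
  open CommutativeSemigroupProperties (⊕-commutativeSemigroup n) public
    using () renaming (interchange to ⊕-interchange; x∙yz≈y∙xz to ⊕-leftComm)

⊕-cancelˡ : (u v : V n) → u ⊕ (u ⊕ v) ≡ v
⊕-cancelˡ u v = begin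
  u ⊕ (u ⊕ v)  ≡⟨ ⊕-assoc u u v ⟨
  (u ⊕ u) ⊕ v  ≡⟨ cong (_⊕ v) (⊕-same u) ⟩
  𝟘 ⊕ v        ≡⟨ ⊕-identityˡ v ⟩
  v            ∎
  where open ≡-Reasoning

⊕-cancel-interchange : (u v w : V n) → (u ⊕ w) ⊕ (v ⊕ w) ≡ u ⊕ v
⊕-cancel-interchange u v w = begin
  (u ⊕ w) ⊕ (v ⊕ w)  ≡⟨ ⊕-interchange u w v w ⟩
  (u ⊕ v) ⊕ (w ⊕ w)  ≡⟨ cong ((u ⊕ v) ⊕_) (⊕-same w) ⟩
  (u ⊕ v) ⊕ 𝟘        ≡⟨ ⊕-identityʳ (u ⊕ v) ⟩
  u ⊕ v              ∎
  where open ≡-Reasoning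

tabulate-const : ∀ n {x : Bool} → tabulate {n = n} (λ _ → x) ≡ replicate n x
tabulate-const ℕ.zero    = refl
tabulate-const (ℕ.suc n) = cong (_ ∷_) (tabulate-const n)

e-zero : e {ℕ.suc n} zero ≡ true ∷ 𝟘
e-zero {n} = cong (true ∷_) (tabulate-const n)

e-suc : (i : Fin n) → e {ℕ.suc n} (suc i) ≡ false ∷ e i
e-suc i = cong (false ∷_) (VecP.tabulate-cong same-test)
  where
  same-test : ∀ j → ⌊ suc i ≟ suc j ⌋ ≡ ⌊ i ≟ j ⌋
  same-test j with i ≟ j
  ... | yes _ = refl
  ... | no _  = refl

lookup-vv : {i j : Fin n} → i ≢ j → lookup (vv i) j ≡ true
lookup-vv {i = i} {j} i≢j = begin
  lookup (𝟙 ⊕ e i) j             ≡⟨ VecP.lookup-zipWith _xor_ j 𝟙 (e i) ⟩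
  lookup 𝟙 j xor lookup (e i) j  ≡⟨ cong₂ _xor_ (VecP.lookup-replicate j true) (VecP.lookup∘tabulate _ j) ⟩
  true xor ⌊ i ≟ j ⌋             ≡⟨ cong (true xor_) (distinct-test (i ≟ j)) ⟩
  true                           ∎
  where
  open ≡-Reasoning
  distinct-test : (i≟j : Dec (i ≡ j)) → ⌊ i≟j ⌋ ≡ false
  distinct-test (yes i≡j) = contradiction i≡j i≢j
  distinct-test (no _)    = refl

-- Linear combinations and spans

lincomb-𝟘 : (L : Vec (V n) d) → lincomb 𝟘 L ≡ 𝟘
lincomb-𝟘 []      = refl
lincomb-𝟘 (_ ∷ L) = lincomb-𝟘 L

lincomb-⊕ : (c c′ : Vec Bool d) (L : Vec (V n) d) →
            lincomb (c ⊕ c′) L ≡ lincomb c L ⊕ lincomb c′ L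
lincomb-⊕ []           []            []      = sym (⊕-identityˡ 𝟘)
lincomb-⊕ (true ∷ c)   (true ∷ c′)   (b ∷ L) =
  trans (lincomb-⊕ c c′ L)
        (sym (trans (cong₂ _⊕_ (⊕-comm b _) (⊕-comm b _)) (⊕-cancel-interchange _ _ b)))
lincomb-⊕ (true ∷ c)   (false ∷ c′)  (b ∷ L) =
  trans (cong (b ⊕_) (lincomb-⊕ c c′ L)) (sym (⊕-assoc b _ _))
lincomb-⊕ (false ∷ c)  (true ∷ c′)   (b ∷ L) =
  trans (cong (b ⊕_) (lincomb-⊕ c c′ L)) (⊕-leftComm b _ _)
lincomb-⊕ (false ∷ c)  (false ∷ c′)  (b ∷ L) = lincomb-⊕ c c′ L

lincomb-++ : (c : Vec Bool d) (c′ : Vec Bool m) (L : Vec (V n) d) (M : Vec (V n) m) →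
             lincomb (c ++ c′) (L ++ M) ≡ lincomb c L ⊕ lincomb c′ M
lincomb-++ []          c′ []      M = sym (⊕-identityˡ _)
lincomb-++ (true ∷ c)  c′ (b ∷ L) M = trans (cong (b ⊕_) (lincomb-++ c c′ L M)) (sym (⊕-assoc b _ _))
lincomb-++ (false ∷ c) c′ (b ∷ L) M = lincomb-++ c c′ L M

lincomb-map-false∷ : (c : Vec Bool d) (M : Vec (V n) d) →
                     lincomb c (map (false ∷_) M) ≡ false ∷ lincomb c M
lincomb-map-false∷ []          []      = refl
lincomb-map-false∷ (true ∷ c)  (b ∷ M) = cong ((false ∷ b) ⊕_) (lincomb-map-false∷ c M)
lincomb-map-false∷ (false ∷ c) (b ∷ M) = lincomb-map-false∷ c M

lincomb-e : (v : V n) → lincomb v (tabulate e) ≡ v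
lincomb-e []      = refl
lincomb-e (a ∷ v) = begin
  lincomb (a ∷ v) (e zero ∷ tabulate (e ∘ suc))
    ≡⟨ cong₂ (λ b M → lincomb (a ∷ v) (b ∷ M)) e-zero
             (trans (VecP.tabulate-cong e-suc) (VecP.tabulate-∘ (false ∷_) e)) ⟩
  lincomb (a ∷ v) ((true ∷ 𝟘) ∷ map (false ∷_) (tabulate e))
    ≡⟨ head-step a ⟩
  a ∷ lincomb v (tabulate e)
    ≡⟨ cong (a ∷_) (lincomb-e v) ⟩
  a ∷ v ∎
  where
  open ≡-Reasoning
  head-step : ∀ a → lincomb (a ∷ v) ((true ∷ 𝟘) ∷ map (false ∷_) (tabulate e))
                    ≡ a ∷ lincomb v (tabulate e)
  head-step true  = trans (cong ((true ∷ 𝟘) ⊕_) (lincomb-map-false∷ v (tabulate e)))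
                          (cong (true ∷_) (⊕-identityˡ _))
  head-step false = lincomb-map-false∷ v (tabulate e)

span-𝟘 : (L : Vec (V n) d) → InSpan L 𝟘
span-𝟘 L = 𝟘 , lincomb-𝟘 L

span-⊕ : {L : Vec (V n) d} {u v : V n} → InSpan L u → InSpan L v → InSpan L (u ⊕ v)
span-⊕ {L = L} (c , refl) (c′ , refl) = c ⊕ c′ , lincomb-⊕ c c′ L

span-isSubspace : (L : Vec (V n) d) → IsSubspace (InSpan L)
span-isSubspace L = record { has-zero = span-𝟘 L ; closed-⊕ = span-⊕ }

span-hasDim : {L : Vec (V n) d} → LinIndep L → HasDim (InSpan L) d
span-hasDim {L = L} independent = span-isSubspace L , L , independent , (λ _ → id) , (λ _ → id)

span-lincomb : {L : Vec (V n) d} {M : Vec (V n) m} →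
               All (InSpan L) M → (c : Vec Bool m) → InSpan L (lincomb c M)
span-lincomb {L = L} []         []          = span-𝟘 L
span-lincomb         (b∈ ∷ M∈) (true ∷ c)  = span-⊕ b∈ (span-lincomb M∈ c)
span-lincomb         (_ ∷ M∈)  (false ∷ c) = span-lincomb M∈ c

span-e⇒span-all : {L : Vec (V n) d} → (∀ i → InSpan L (e i)) → ∀ v → InSpan L v
span-e⇒span-all {L = L} e∈L v = subst (InSpan L) (lincomb-e v) (span-lincomb (tabulate⁺ e∈L) v)

span-++ˡ : (L : Vec (V n) d) (M : Vec (V n) m) {v : V n} → InSpan L v → InSpan (L ++ M) v
span-++ˡ L M (c , refl) =
  c ++ 𝟘 , trans (lincomb-++ c 𝟘 L M) (trans (cong (_ ⊕_) (lincomb-𝟘 M)) (⊕-identityʳ _))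

span-++ʳ : (L : Vec (V n) d) (M : Vec (V n) m) {v : V n} → InSpan M v → InSpan (L ++ M) v
span-++ʳ L M (c , refl) =
  𝟘 ++ c , trans (lincomb-++ 𝟘 c L M) (trans (cong (_⊕ _) (lincomb-𝟘 L)) (⊕-identityˡ _))

span-map-false∷ : {M : Vec (V n) d} {v : V n} → InSpan M v → InSpan (map (false ∷_) M) (false ∷ v)
span-map-false∷ {M = M} (c , refl) = c , lincomb-map-false∷ c M

span-∷ʳ : {L : Vec (V n) d} {w v : V n} → InSpan L v → InSpan (w ∷ L) v
span-∷ʳ (c , eq) = false ∷ c , eq

span-∷-⊕ : {L : Vec (V n) d} {w v : V n} → InSpan L (w ⊕ v) → InSpan (w ∷ L) v
span-∷-⊕ {w = w} {v} (c , eq) = true ∷ c , trans (cong (w ⊕_) eq) (⊕-cancelˡ w v)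

span-∷-head : {L : Vec (V n) d} {w : V n} → InSpan (w ∷ L) w
span-∷-head {L = L} {w} = span-∷-⊕ (subst (InSpan L) (sym (⊕-same w)) (span-𝟘 L))

span-∷⁻ : {L : Vec (V n) d} {w v : V n} → InSpan (w ∷ L) v → InSpan L v ⊎ InSpan L (w ⊕ v)
span-∷⁻         (false ∷ c , eq) = inj₁ (c , eq)
span-∷⁻ {w = w} (true ∷ c , eq)  = inj₂ (c , trans (sym (⊕-cancelˡ w _)) (cong (w ⊕_) eq))

∉span-∷ : {L : Vec (V n) d} {w v : V n} → ¬ InSpan (w ∷ L) v → ¬ InSpan L v × ¬ InSpan L (w ⊕ v)
∉span-∷ v∉ = v∉ ∘ span-∷ʳ , v∉ ∘ span-∷-⊕

∷-linIndep : {L : Vec (V n) d} {w : V n} → LinIndep L → ¬ InSpan L w → LinIndep (w ∷ L)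
∷-linIndep {w = w} independent w∉ (true ∷ c) eq =
  contradiction (c , trans (sym (⊕-cancelˡ w _)) (trans (cong (w ⊕_) eq) (⊕-identityʳ w))) w∉
∷-linIndep independent w∉ (false ∷ c) eq = cong (false ∷_) (independent c eq)

span-∩ : {L : Vec (V n) d} {w w′ : V n} → ¬ InSpan L (w ⊕ w′) →
         ∀ v → InSpan L v ⇔ (InSpan (w ∷ L) v × InSpan (w′ ∷ L) v)
span-∩ {L = L} {w} {w′} ww′∉ v =
  mk⇔ (λ v∈ → span-∷ʳ v∈ , span-∷ʳ v∈) (λ (y , y′) → meet (span-∷⁻ y) (span-∷⁻ y′))
  where
  meet : InSpan L v ⊎ InSpan L (w ⊕ v) → InSpan L v ⊎ InSpan L (w′ ⊕ v) → InSpan L v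
  meet (inj₁ v∈) _          = v∈
  meet (inj₂ _)  (inj₁ v∈)  = v∈
  meet (inj₂ x)  (inj₂ x′)  =
    contradiction (subst (InSpan L) (⊕-cancel-interchange w w′ v) (span-⊕ x x′)) ww′∉

-- Counting dimensions

funToFin-cong : {f g : Fin m → Fin n} → (∀ i → f i ≡ g i) → funToFin f ≡ funToFin g
funToFin-cong {m = ℕ.zero}  f≗g = refl
funToFin-cong {m = ℕ.suc m} f≗g = cong₂ combine (f≗g zero) (funToFin-cong (f≗g ∘ suc))

Vec-Bool↔Fin : Vec Bool n ↔ Fin (2 ^ n)
Vec-Bool↔Fin {n} = mk↔ₛ′ toFin fromFin toFin∘fromFin fromFin∘toFin
  where
  open Inverse (FinP.2↔Bool) renaming (to to toBool; from to fromBool)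
  toFin : Vec Bool n → Fin (2 ^ n)
  toFin v = funToFin (fromBool ∘ lookup v)
  fromFin : Fin (2 ^ n) → Vec Bool n
  fromFin i = tabulate (toBool ∘ finToFun i)
  toFin∘fromFin : ∀ i → toFin (fromFin i) ≡ i
  toFin∘fromFin i = trans
    (funToFin-cong {m = n} λ j → trans (cong fromBool (VecP.lookup∘tabulate (toBool ∘ finToFun i) j))
                               (strictlyInverseʳ (finToFun i j)))
    (FinP.funToFin-finToFin {n} i)
  fromFin∘toFin : ∀ v → fromFin (toFin v) ≡ v
  fromFin∘toFin v = trans
    (VecP.tabulate-cong (λ j → trans (cong toBool (FinP.finToFun-funToFin _ j)) (strictlyInverseˡ _)))
    (VecP.tabulate∘lookup v)

Vec-Bool-injective⇒≤ : {f : Vec Bool m → Vec Bool n} → Injective _≡_ _≡_ f → m ≤ n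
Vec-Bool-injective⇒≤ {m} {n} f-injective =
  ℕP.≮⇒≥ (λ n<m → ℕP.<⇒≱ (ℕP.^-monoʳ-< 2 (s≤s (s≤s z≤n)) n<m) 2^m≤2^n)
  where
  toFin-injective : Injective _≡_ _≡_ (Inverse.to (Vec-Bool↔Fin {n}))
  toFin-injective = Injection.injective (↔⇒↣ (Vec-Bool↔Fin {n}))
  fromFin-injective : Injective _≡_ _≡_ (Inverse.from (Vec-Bool↔Fin {m}))
  fromFin-injective = Injection.injective (↔⇒↣ (↔-sym (Vec-Bool↔Fin {m})))
  2^m≤2^n : 2 ^ m ≤ 2 ^ n
  2^m≤2^n = FinP.injective⇒≤
    (Composition.injective _≡_ _≡_ _≡_
      (Composition.injective _≡_ _≡_ _≡_ fromFin-injective f-injective) toFin-injective)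

spanning⇒≤ : (L : Vec (V n) d) → (∀ i → InSpan L (e i)) → n ≤ d
spanning⇒≤ L e∈L = Vec-Bool-injective⇒≤ {f = coefficients} λ {u} {v} eq → begin
  u                         ≡⟨ proj₂ (span-e⇒span-all e∈L u) ⟨
  lincomb (coefficients u) L ≡⟨ cong (λ c → lincomb c L) eq ⟩
  lincomb (coefficients v) L ≡⟨ proj₂ (span-e⇒span-all e∈L v) ⟩
  v                         ∎
  where
  open ≡-Reasoning
  coefficients : V _ → Vec Bool _
  coefficients v = proj₁ (span-e⇒span-all e∈L v)

∃-Vec-Bool? : {P : Vec Bool d → Set} → Decidable P → Dec (∃ P)
∃-Vec-Bool? {d} {P} P? =
  map′ (λ (i , p) → from i , p) (λ (c , p) → to c , subst P (sym (strictlyInverseʳ c)) p)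
       (FinP.any? (P? ∘ from))
  where open Inverse (Vec-Bool↔Fin {d})

∀-Vec-Bool? : {P : Vec Bool d → Set} → Decidable P → Dec (∀ c → P c)
∀-Vec-Bool? {d} {P} P? =
  map′ (λ ∀P c → subst P (strictlyInverseʳ c) (∀P (to c))) (λ ∀P → ∀P ∘ from)
       (FinP.all? (P? ∘ from))
  where open Inverse (Vec-Bool↔Fin {d})

span? : (L : Vec (V n) d) → Decidable (InSpan L)
span? L v = ∃-Vec-Bool? (λ c → VecP.≡-dec Bool._≟_ (lincomb c L) v)

∃-e∉span : (L : Vec (V n) d) → d < n → ∃ λ i → ¬ InSpan L (e i)
∃-e∉span {n} L d<n = FinP.¬∀⟶∃¬ n _ (span? L ∘ e) (λ e∈L → ℕP.<⇒≱ d<n (spanning⇒≤ L e∈L))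

e-vectors : (s : Subset n) → Vec (V n) ∣ s ∣
e-vectors []          = []
e-vectors (true ∷ s)  = e zero ∷ map (false ∷_) (e-vectors s)
e-vectors (false ∷ s) = map (false ∷_) (e-vectors s)

e∈span-e-vectors : {s : Subset n} {i : Fin n} → i ∈ s → InSpan (e-vectors s) (e i)
e∈span-e-vectors {s = true ∷ s}  here        = span-∷-head
e∈span-e-vectors {s = true ∷ s}  (there i∈s) =
  subst (InSpan _) (sym (e-suc _)) (span-∷ʳ (span-map-false∷ (e∈span-e-vectors i∈s)))
e∈span-e-vectors {s = false ∷ s} (there i∈s) =
  subst (InSpan _) (sym (e-suc _)) (span-map-false∷ (e∈span-e-vectors i∈s))

∃-e∉span-outside : (L : Vec (V n) d) (s : Subset n) → d + ∣ s ∣ < n →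
                   ∃ λ i → ¬ i ∈ s × ¬ InSpan L (e i)
∃-e∉span-outside L s d+∣s∣<n with ∃-e∉span (L ++ e-vectors s) d+∣s∣<n
... | i , eᵢ∉ = i , eᵢ∉ ∘ span-++ʳ L _ ∘ e∈span-e-vectors , eᵢ∉ ∘ span-++ˡ L _

-- Coordinate hyperplanes

InC-antitone : {X Y : Pred n} {i : Fin n} → (∀ v → X v → Y v) → InC Y i → InC X i
InC-antitone X⊆Y Y⊆Cᵢ v v∈X = Y⊆Cᵢ v (X⊆Y v v∈X)

c≤-mono : {X Y : Pred n} → (∀ v → X v → Y v) → c≤ X m → c≤ Y m
c≤-mono X⊆Y cX s s⊆C = cX s (λ i i∈s → InC-antitone X⊆Y (s⊆C i i∈s))

∋⇒¬InC : {Y : Pred n} {u : V n} {i : Fin n} → Y u → lookup u i ≡ true → ¬ InC Y i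
∋⇒¬InC u∈Y uᵢ≡true Y⊆Cᵢ = contradiction (trans (sym uᵢ≡true) (Y⊆Cᵢ _ u∈Y)) λ ()

∋𝟙⇒¬InC : {Y : Pred n} → Y 𝟙 → ∀ i → ¬ InC Y i
∋𝟙⇒¬InC 𝟙∈Y i = ∋⇒¬InC 𝟙∈Y (VecP.lookup-replicate i true)

∋vv⇒¬InC : {Y : Pred n} {i : Fin n} → Y (vv i) → ¬ InC Y i → ∀ j → ¬ InC Y j
∋vv⇒¬InC {i = i} vvᵢ∈Y ¬Cᵢ j with i ≟ j
... | yes refl = ¬Cᵢ
... | no i≢j   = ∋⇒¬InC vvᵢ∈Y (lookup-vv i≢j)

InC-span? : (L : Vec (V n) d) → Decidable (InC (InSpan L))
InC-span? L i = map′ (λ ∀c → λ { v (c , refl) → ∀c c }) (λ L⊆Cᵢ c → L⊆Cᵢ _ (c , refl))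
  (∀-Vec-Bool? λ c → lookup (lincomb c L) i Bool.≟ false)

subset : {P : Fin n → Set} → Decidable P → Subset n
subset P? = tabulate (⌊_⌋ ∘ P?)

∈-subset⁺ : {P : Fin n → Set} (P? : Decidable P) {i : Fin n} → P i → i ∈ subset P?
∈-subset⁺ P? {i} p = VecP.lookup⇒[]= i _
  (trans (VecP.lookup∘tabulate _ i) (Equivalence.to BoolP.T-≡ (fromWitness {a? = P? i} p)))

∈-subset⁻ : {P : Fin n → Set} (P? : Decidable P) {i : Fin n} → i ∈ subset P? → P i
∈-subset⁻ P? {i} i∈ = toWitness {a? = P? i}
  (Equivalence.from BoolP.T-≡ (trans (sym (VecP.lookup∘tabulate _ i)) (VecP.[]=⇒lookup i∈)))

GoodIndex : Vec (V n) d → Set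
GoodIndex B = ∃ λ i → ¬ InC (InSpan B) i × ¬ InSpan B (e i) × ¬ InSpan B (vv i)

good-index-in-no-C : (B : Vec (V n) m) → ℕ.suc m < n → (∀ i → ¬ InC (InSpan B) i) → GoodIndex B
good-index-in-no-C B k<n ¬C with ∃-e∉span (𝟙 ∷ B) k<n
... | i , eᵢ∉ = i , ¬C i , ∉span-∷ eᵢ∉

good-index-in-some-C : (B : Vec (V n) m) → ℕ.suc m < n → c≤ (InSpan B) (n ∸ ℕ.suc m) →
                       {z : Fin n} → InC (InSpan B) z → GoodIndex B
good-index-in-some-C {n} {m} B k<n cB {z} C_z = good (∃-e∉span-outside B Z m+∣Z∣<n)
  where
  Z : Subset n
  Z = subset (InC-span? B)
  m+∣Z∣<n : m + ∣ Z ∣ < n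
  m+∣Z∣<n = ℕP.≤-trans (s≤s (ℕP.+-monoʳ-≤ m (cB Z (λ _ → ∈-subset⁻ (InC-span? B)))))
                       (ℕP.≤-reflexive (ℕP.m+[n∸m]≡n (ℕP.<⇒≤ k<n)))
  good : (∃ λ i → ¬ i ∈ Z × ¬ InSpan B (e i)) → GoodIndex B
  good (i , i∉Z , eᵢ∉) = i , ¬Cᵢ , eᵢ∉ , vvᵢ∉
    where
    ¬Cᵢ : ¬ InC (InSpan B) i
    ¬Cᵢ = i∉Z ∘ ∈-subset⁺ (InC-span? B)
    vvᵢ∉ : ¬ InSpan B (vv i)
    vvᵢ∉ vvᵢ∈ = ∋⇒¬InC vvᵢ∈ (lookup-vv {i = i} {z} λ { refl → ¬Cᵢ C_z }) C_z

good-index : (B : Vec (V n) m) → ℕ.suc m < n → c≤ (InSpan B) (n ∸ ℕ.suc m) → GoodIndex B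
good-index B k<n cB with FinP.any? (InC-span? B)
... | yes (_ , C_z) = good-index-in-some-C B k<n cB C_z
... | no  ¬C        = good-index-in-no-C B k<n (λ i C → ¬C (i , C))

-- Splitting by two extensions

SpecialSplitting : ∀ n k → Pred n → Set₁
SpecialSplitting n k X = Σ (Pred n) λ Y → Σ (Pred n) λ Y′ →
  InCnk n k Y × InCnk n k Y′ × (∀ v → X v ⇔ (Y v × Y′ v)) × ContainsSpecial Y × ContainsSpecial Y′

SpecialSplitting-resp : {k : ℕ} {X X′ : Pred n} → (∀ v → X v ⇔ X′ v) →
                        SpecialSplitting n k X′ → SpecialSplitting n k X
SpecialSplitting-resp X⇔X′ (Y , Y′ , Y∈𝒞 , Y′∈𝒞 , X′⇔Y∩Y′ , Y-special , Y′-special) =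
  Y , Y′ , Y∈𝒞 , Y′∈𝒞 , (λ v → X′⇔Y∩Y′ v ⇔-∘ X⇔X′ v) , Y-special , Y′-special

splitting-by-extensions : {B : Vec (V n) m} {w w′ : V n} → LinIndep B →
  ¬ InSpan B w → ¬ InSpan B w′ → ¬ InSpan B (w ⊕ w′) →
  (∀ i → ¬ InC (InSpan (w ∷ B)) i) → (∀ i → ¬ InC (InSpan (w′ ∷ B)) i) →
  ContainsSpecial (InSpan (w ∷ B)) → ContainsSpecial (InSpan (w′ ∷ B)) →
  SpecialSplitting n (ℕ.suc m) (InSpan B)
splitting-by-extensions {w = w} {w′} independent w∉ w′∉ ww′∉ ¬C ¬C′ special special′ =
  InSpan (w ∷ _) , InSpan (w′ ∷ _) ,
  (span-hasDim (∷-linIndep independent w∉) , ¬C) , (span-hasDim (∷-linIndep independent w′∉) , ¬C′) ,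
  span-∩ ww′∉ , special , special′

splitting-with-𝟙 : {B : Vec (V n) m} → LinIndep B → ℕ.suc m < n → InSpan B 𝟙 →
                   SpecialSplitting n (ℕ.suc m) (InSpan B)
splitting-with-𝟙 {B = B} independent k<n 𝟙∈B with ∃-e∉span B (ℕP.<-trans (ℕP.n<1+n _) k<n)
... | i , eᵢ∉ with ∃-e∉span (e i ∷ B) k<n
...   | j , eⱼ∉ = splitting-by-extensions independent eᵢ∉ (proj₁ (∉span-∷ eⱼ∉)) (proj₂ (∉span-∷ eⱼ∉))
                    (∋𝟙⇒¬InC 𝟙∈Y) (∋𝟙⇒¬InC 𝟙∈Y) (inj₁ 𝟙∈Y) (inj₁ 𝟙∈Y)
  where
  𝟙∈Y : {w : V _} → InSpan (w ∷ B) 𝟙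
  𝟙∈Y = span-∷ʳ 𝟙∈B

splitting-without-𝟙 : {B : Vec (V n) m} → LinIndep B → ¬ InSpan B 𝟙 → GoodIndex B →
                      SpecialSplitting n (ℕ.suc m) (InSpan B)
splitting-without-𝟙 independent 𝟙∉B (i , ¬Cᵢ , eᵢ∉ , vvᵢ∉) =
  splitting-by-extensions independent 𝟙∉B vvᵢ∉ (eᵢ∉ ∘ subst (InSpan _) (⊕-cancelˡ 𝟙 (e i)))
    (∋𝟙⇒¬InC span-∷-head) (∋vv⇒¬InC span-∷-head (¬Cᵢ ∘ InC-antitone (λ _ → span-∷ʳ)))
    (inj₁ span-∷-head) (inj₂ (i , span-∷-head))

span-splitting : {B : Vec (V n) m} → LinIndep B → ℕ.suc m < n → c≤ (InSpan B) (n ∸ ℕ.suc m) →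
                 SpecialSplitting n (ℕ.suc m) (InSpan B)
span-splitting {B = B} independent k<n cB with span? B 𝟙
... | yes 𝟙∈B = splitting-with-𝟙 independent k<n 𝟙∈B
... | no  𝟙∉B = splitting-without-𝟙 independent 𝟙∉B (good-index B k<n cB)

lemma12 : ∀ (n k : ℕ) → 3 ≤ k → k < n ∸ 1 →
    ∀ (X : Pred n) → HasDim X (k ∸ 1) → c≤ X (n ∸ k) →
    Σ (Pred n) λ Y → Σ (Pred n) λ Y′ →
      InCnk n k Y × InCnk n k Y′ ×
      (∀ v → X v ⇔ (Y v × Y′ v)) ×
      ContainsSpecial Y × ContainsSpecial Y′
lemma12 ℕ.zero    _         _ ()
lemma12 (ℕ.suc n) ℕ.zero    ()
lemma12 (ℕ.suc n) (ℕ.suc m) _ k<n X (_ , B , independent , X⊆B , B⊆X) cX =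
  SpecialSplitting-resp (λ v → mk⇔ (X⊆B v) (B⊆X v))
    (span-splitting independent (ℕP.m<n⇒m<1+n k<n) (c≤-mono X⊆B cX))
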